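{- Let $G$ be a finite connected graph (multiple edges allowed) and let $\{x,y\}$ be a generating pair for $G$. Let $\ell \ge 1$ be an integer and let $\tilde{G}$ be the graph obtained from $G$ by adding a new path of $\ell$ edges between $x$ and $y$; that is, $V(\tilde G)=V(G)\cup\{x_1,\ldots,x_{\ell-1}\}$ with $\ell-1$ new vertices, and $E(\tilde G)$ consists of the edges of $G$ together with new edges $x_0x_1, x_1x_2,\ldots,x_{\ell-1}x_\ell$, where $x_0=x$ and $x_\ell=y$ (for $\ell=1$ this adds one new edge between $x$ and $y$). Then for every $0\le i\le \ell-1$, the pair $\{x_i,x_{i+1}\}$ is a generating pair for $\tilde{G}$. In particular, the critical group $K(\tilde{G})$ is cyclic.
   Context: A configuration on a finite connected graph $G$ is a function $\delta: V(G)\to\mathbb{Z}$; its degree is $\sum_v \delta(v)$. A move consists of choosing a vertex $v$ and either firing (sending one chip along each edge incident to $v$ to the other endpoint, so $v$ loses its degree and each neighbor gains the number of edges joining it to $v$) or borrowing (the reverse). Two configurations are equivalent if one can be obtained from the other by a finite sequence of moves. The critical group $K(G)$ is the abelian group of equivalence classes of degree-zero configurations under vertexwise addition. For vertices $x,y$, $\delta_{x,y}$ is the configuration with $\delta_{x,y}(x)=1$, $\delta_{x,y}(y)=-1$, and $0$ elsewhere. A pair $\{x,y\}\subset V(G)$ is a generating pair if the class of $\delta_{x,y}$ generates $K(G)$; equivalently, every degree-zero configuration is equivalent to one that is zero except possibly at $x$ and $y$. -}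

module Defs where

open import Data.Nat using (ℕ; zero; suc; _+_)
open import Data.Integer using (ℤ; +_; _-_) renaming (_+_ to _+ℤ_; _*_ to _*ℤ_)
open import Data.Fin using (Fin; zero; suc; _↑ˡ_; _↑ʳ_; inject₁)
open import Data.Fin.Properties using (_≟_)
open import Data.Maybe using (Maybe; just; nothing; maybe)
import Data.Maybe as Maybe
open import Data.List using (List; []; _∷_; _++_; map; allFin)
open import Data.List.Membership.Propositional using (_∈_)
open import Data.Product using (_×_; _,_; ∃; ∃-syntax)
open import Data.Sum using (_⊎_)
open import Relation.Nullary using (yes; no)
open import Relation.Binary.PropositionalEquality using (_≡_)
open import Relation.Binary.Construct.Closure.ReflexiveTransitive using (Star)

-- A finite multigraph on vertex set Fin n, given by its (finite) list of
-- edges; each pair (a , b) is one undirected edge joining a and b.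
-- Repetitions give multiple edges.
Graph : ℕ → Set
Graph n = List (Fin n × Fin n)

Adjacent : ∀ {n} → Graph n → Fin n → Fin n → Set
Adjacent G a b = ((a , b) ∈ G) ⊎ ((b , a) ∈ G)

Connected : ∀ {n} → Graph n → Set
Connected G = ∀ a b → Star (Adjacent G) a b

Config : ℕ → Set
Config n = Fin n → ℤ

𝟙 : ∀ {n} → Fin n → Config n
𝟙 v w with v ≟ w
... | yes _ = + 1
... | no _ = + 0

δ : ∀ {n} → Fin n → Fin n → Config n
δ x y w = 𝟙 x w - 𝟙 y w

-- Change of the configuration caused by firing v, contribution of one edge:
-- along edge (a , b), if v is the endpoint a then a sends one chip to b,
-- and if v is the endpoint b then b sends one chip to a.
edgeFire : ∀ {n} → Fin n → Fin n × Fin n → Config n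
edgeFire v (a , b) w = 𝟙 v a *ℤ δ b a w +ℤ 𝟙 v b *ℤ δ a b w

fireChange : ∀ {n} → Graph n → Fin n → Config n
fireChange [] v w = + 0
fireChange (e ∷ G) v w = edgeFire v e w +ℤ fireChange G v w

Move : ∀ {n} → Graph n → Config n → Config n → Set
Move G σ τ = ∃[ v ] ((∀ w → τ w ≡ σ w +ℤ fireChange G v w)
                    ⊎ (∀ w → τ w ≡ σ w - fireChange G v w))

data _∼⟨_⟩_ {n} (σ : Config n) (G : Graph n) : Config n → Set where
  done : ∀ {τ} → (∀ w → σ w ≡ τ w) → σ ∼⟨ G ⟩ τ
  step : ∀ {ρ τ} → Move G σ ρ → ρ ∼⟨ G ⟩ τ → σ ∼⟨ G ⟩ τ

degree : ∀ {n} → Config n → ℤ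
degree {zero} σ = + 0
degree {suc n} σ = σ zero +ℤ degree (λ i → σ (suc i))

-- {x,y} is a generating pair: the class of δ_{x,y} generates K(G), i.e.
-- every degree-zero configuration is equivalent to an integer multiple of δ_{x,y}.
GeneratingPair : ∀ {n} → Graph n → Fin n → Fin n → Set
GeneratingPair {n} G x y =
  (σ : Config n) → degree σ ≡ + 0 → ∃[ k ] (σ ∼⟨ G ⟩ (λ w → k *ℤ δ x y w))

-- Adding a path of ℓ = suc m edges between x and y.
-- New vertices x_1 … x_m are  n ↑ʳ 0 , … , n ↑ʳ (m-1).
-- splitLast m j = just j if j < m, nothing if j = m.
splitLast : ∀ m → Fin (suc m) → Maybe (Fin m)
splitLast zero zero = nothing
splitLast (suc m) zero = just zero
splitLast (suc m) (suc j) = Maybe.map suc (splitLast m j)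

-- pathVertex x y m i = x_i  for i = 0, …, ℓ  (x_0 = x, x_ℓ = y)
pathVertex : ∀ {n} → Fin n → Fin n → (m : ℕ) → Fin (suc (suc m)) → Fin (n + m)
pathVertex x y m zero = x ↑ˡ m
pathVertex {n} x y m (suc j) = maybe (n ↑ʳ_) (y ↑ˡ m) (splitLast m j)

addPath : ∀ {n} → Graph n → Fin n → Fin n → (m : ℕ) → Graph (n + m)
addPath G x y m =
  map (λ { (a , b) → (a ↑ˡ m , b ↑ˡ m) }) G
  ++ map (λ i → (pathVertex x y m (inject₁ i) , pathVertex x y m (suc i))) (allFin (suc m))

-- Write x_t for pathVertex x y m t and d_j = δ x_j x_(j+1) for the new edges. Firing the inner
-- vertex x_(j+1) turns d_(j+1) into d_j, so all the d_j are equivalent in G̃ and, telescoping,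
-- every δ x_t x_0 is a multiple of d_i. Firing an old vertex in G differs from firing it in G̃
-- by its firing along the path, which is a combination of the d_j; hence an equivalence in G
-- lifts to G̃ up to multiples of d_i. Applied to δ u x ∼ k δ x y = −k δ x_ℓ x_0, this makes
-- δ u x_0 a multiple of d_i for every old vertex u too, and the δ w x_0 span all configurations
-- of degree zero.
module Submission where

open import Defs
open import Data.Nat using (ℕ; suc)
open import Data.Fin using (Fin; suc; inject₁)
open import Relation.Binary.PropositionalEquality using (_≢_)

import Data.Nat as ℕ
open import Data.Nat using (zero)
open import Data.Fin using (zero; fromℕ; _↑ˡ_; _↑ʳ_; splitAt)
open import Data.Fin.Properties
  using (_≟_; suc-injective; inject₁-injective; ↑ˡ-injective; ↑ʳ-injective;
         splitAt-↑ˡ; splitAt-↑ʳ; splitAt⁻¹-↑ˡ; splitAt⁻¹-↑ʳ)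
open import Data.Fin.Induction using (<-weakInduction)
open import Data.Integer using (ℤ; +_; -[1+_]; -_; _+_; _-_; _*_)
open import Data.Integer.Properties
  using (+-*-semiring; +-comm; +-assoc; +-identityˡ; +-identityʳ; +-inverseʳ; neg-distrib-+;
         *-assoc; *-identityˡ; *-identityʳ; *-zeroʳ; *-distribʳ-+; suc-*; neg-distribˡ-*; -1*i≡-i)
open import Data.Integer.Tactic.RingSolver using (solve-∀)
open import Algebra.Properties.Semiring.Sum +-*-semiring
  using (sum; sum-syntax; sum-cong-≗; sum-replicate-zero; *-distribˡ-sum)
open import Data.Maybe using (just; nothing)
open import Data.Product using (_×_; _,_; proj₁; proj₂; ∃-syntax)
open import Data.Sum using (inj₁; inj₂)
open import Data.Empty using (⊥-elim)
open import Data.List using ([]; _∷_; _++_; map; tabulate; allFin)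
open import Data.List.Properties using (map-tabulate)
open import Data.List.Relation.Unary.All using (All; []; _∷_; universal)
open import Data.List.Relation.Unary.All.Properties using (map⁺; tabulate⁺)
import Data.Vec.Functional as Vector
open import Data.Vec.Functional.Properties using (lookup-++ˡ; lookup-++ʳ)
open import Relation.Nullary using (yes; no)
open import Relation.Binary.PropositionalEquality
  using (_≡_; _≗_; refl; sym; trans; cong; cong₂; subst; module ≡-Reasoning)
open import Function using (id; _∘_; _⇔_; mk⇔; Equivalence; Injective)

module _ {N : ℕ} where
  infixl 6 _⊕_ _⊖_
  infixr 7 _·_

  _⊕_ _⊖_ : Config N → Config N → Config N
  (σ ⊕ τ) w = σ w + τ w
  (σ ⊖ τ) w = σ w - τ w

  ⊝_ : Config N → Config N
  (⊝ σ) w = - σ w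

  _·_ : ℤ → Config N → Config N
  (k · σ) w = k * σ w

  𝟎 : Config N
  𝟎 _ = + 0

  ∑ᶜ : ∀ {k} → (Fin k → Config N) → Config N
  ∑ᶜ {k} f w = ∑[ j < k ] f j w

i+j-j≡i : ∀ i j → i + j - j ≡ i
i+j-j≡i = solve-∀

i-j+j≡i : ∀ i j → i - j + j ≡ i
i-j+j≡i = solve-∀

i+[j-i]≡j : ∀ i j → i + (j - i) ≡ j
i+[j-i]≡j = solve-∀

degree≡sum : ∀ {N} (σ : Config N) → degree σ ≡ sum σ
degree≡sum {zero} σ = refl
degree≡sum {suc N} σ = cong (_+_ (σ zero)) (degree≡sum (σ ∘ suc))

∑-distrib-- : ∀ {k} (f g : Fin k → ℤ) → ∑[ i < k ] (f i - g i) ≡ ∑[ i < k ] f i - ∑[ i < k ] g i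
∑-distrib-- {zero} f g = refl
∑-distrib-- {suc k} f g =
  trans (cong (_+_ (f zero - g zero)) (∑-distrib-- (f ∘ suc) (g ∘ suc)))
        (regroup (f zero) (g zero) (∑[ i < k ] f (suc i)) (∑[ i < k ] g (suc i)))
  where
  regroup : ∀ a b c d → a - b + (c - d) ≡ a + c - (b + d)
  regroup = solve-∀

𝟙-cong-⇔ : ∀ {k l} {a b : Fin k} {c d : Fin l} → (a ≡ b ⇔ c ≡ d) → 𝟙 a b ≡ 𝟙 c d
𝟙-cong-⇔ {a = a} {b} {c} {d} a≡b⇔c≡d with a ≟ b | c ≟ d
... | yes _   | yes _   = refl
... | no _    | no _    = refl
... | yes a≡b | no c≢d  = ⊥-elim (c≢d (Equivalence.to a≡b⇔c≡d a≡b))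
... | no a≢b  | yes c≡d = ⊥-elim (a≢b (Equivalence.from a≡b⇔c≡d c≡d))

𝟙-≢ : ∀ {k} {a b : Fin k} → a ≢ b → 𝟙 a b ≡ + 0
𝟙-≢ {a = a} {b} a≢b with a ≟ b
... | yes a≡b = ⊥-elim (a≢b a≡b)
... | no _    = refl

𝟙-sym : ∀ {k} (a b : Fin k) → 𝟙 a b ≡ 𝟙 b a
𝟙-sym a b = 𝟙-cong-⇔ (mk⇔ sym sym)

𝟙-injective : ∀ {k l} {f : Fin k → Fin l} → Injective _≡_ _≡_ f → ∀ a b → 𝟙 (f a) (f b) ≡ 𝟙 a b
𝟙-injective {f = f} f-injective a b = 𝟙-cong-⇔ (mk⇔ f-injective (cong f))

∑-𝟙-* : ∀ {k} (a : Fin k) (f : Fin k → ℤ) → ∑[ i < k ] (𝟙 a i * f i) ≡ f a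
∑-𝟙-* {suc k} zero f = begin
  + 1 * f zero + ∑[ i < k ] (+ 0)  ≡⟨ cong₂ _+_ (*-identityˡ (f zero)) (sum-replicate-zero k) ⟩
  f zero + + 0                     ≡⟨ +-identityʳ (f zero) ⟩
  f zero                           ∎
  where open ≡-Reasoning
∑-𝟙-* {suc k} (suc a) f = begin
  + 0 + ∑[ i < k ] (𝟙 (suc a) (suc i) * f (suc i))  ≡⟨ +-identityˡ _ ⟩
  ∑[ i < k ] (𝟙 (suc a) (suc i) * f (suc i))        ≡⟨ sum-cong-≗ (λ i → cong (_* f (suc i)) (𝟙-suc i)) ⟩
  ∑[ i < k ] (𝟙 a i * f (suc i))                    ≡⟨ ∑-𝟙-* a (f ∘ suc) ⟩
  f (suc a)                                         ∎
  where
  open ≡-Reasoning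
  𝟙-suc : ∀ i → 𝟙 (suc a) (suc i) ≡ 𝟙 a i
  𝟙-suc = 𝟙-injective suc-injective a

∑-δ-* : ∀ {k} (a b : Fin k) (f : Fin k → ℤ) → ∑[ i < k ] (δ a b i * f i) ≡ f a - f b
∑-δ-* {k} a b f = begin
  ∑[ i < k ] (δ a b i * f i)
    ≡⟨ sum-cong-≗ (λ i → *-distribʳ-- (𝟙 a i) (𝟙 b i) (f i)) ⟩
  ∑[ i < k ] (𝟙 a i * f i - 𝟙 b i * f i)
    ≡⟨ ∑-distrib-- (λ i → 𝟙 a i * f i) (λ i → 𝟙 b i * f i) ⟩
  ∑[ i < k ] (𝟙 a i * f i) - ∑[ i < k ] (𝟙 b i * f i)
    ≡⟨ cong₂ _-_ (∑-𝟙-* a f) (∑-𝟙-* b f) ⟩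
  f a - f b
    ∎
  where
  open ≡-Reasoning
  *-distribʳ-- : ∀ p q r → (p - q) * r ≡ p * r - q * r
  *-distribʳ-- = solve-∀

degree-δ : ∀ {k} (a b : Fin k) → degree (δ a b) ≡ + 0
degree-δ {k} a b = begin
  degree (δ a b)              ≡⟨ degree≡sum (δ a b) ⟩
  ∑[ i < k ] δ a b i          ≡⟨ sum-cong-≗ (λ i → sym (*-identityʳ (δ a b i))) ⟩
  ∑[ i < k ] (δ a b i * + 1)  ≡⟨ ∑-δ-* a b (λ _ → + 1) ⟩
  + 0                         ∎
  where open ≡-Reasoning

δ-expansion : ∀ {k} (o : Fin k) (σ : Config k) → degree σ ≡ + 0 → σ ≗ ∑ᶜ (λ w → σ w · δ w o)
δ-expansion {k} o σ deg≡0 v = sym (begin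
  ∑[ w < k ] (σ w * δ w o v)
    ≡⟨ sum-cong-≗ (λ w → cong (λ e → σ w * (e - c)) (𝟙-sym w v)) ⟩
  ∑[ w < k ] (σ w * (𝟙 v w - c))
    ≡⟨ sum-cong-≗ (λ w → expand (σ w) (𝟙 v w) c) ⟩
  ∑[ w < k ] (𝟙 v w * σ w - c * σ w)
    ≡⟨ ∑-distrib-- (λ w → 𝟙 v w * σ w) (λ w → c * σ w) ⟩
  ∑[ w < k ] (𝟙 v w * σ w) - ∑[ w < k ] (c * σ w)
    ≡⟨ cong₂ _-_ (∑-𝟙-* v σ) (sym (*-distribˡ-sum c σ)) ⟩
  σ v - c * sum σ
    ≡⟨ cong (λ s → σ v - c * s) (trans (sym (degree≡sum σ)) deg≡0) ⟩
  σ v - c * + 0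
    ≡⟨ cancel (σ v) c ⟩
  σ v
    ∎)
  where
  open ≡-Reasoning
  c = 𝟙 o v
  expand : ∀ s e t → s * (e - t) ≡ e * s - t * s
  expand = solve-∀
  cancel : ∀ s t → s - t * + 0 ≡ s
  cancel = solve-∀

edgeFire-δ : ∀ {N} (v a b : Fin N) → edgeFire v (a , b) ≗ (𝟙 v b - 𝟙 v a) · δ a b
edgeFire-δ v a b w = regroup (𝟙 v a) (𝟙 v b) (𝟙 a w) (𝟙 b w)
  where
  regroup : ∀ p q r s → p * (s - r) + q * (r - s) ≡ (q - p) * (r - s)
  regroup = solve-∀

fireChange-++ : ∀ {N} (A B : Graph N) v → fireChange (A ++ B) v ≗ fireChange A v ⊕ fireChange B v
fireChange-++ [] B v w = sym (+-identityˡ (fireChange B v w))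
fireChange-++ (e ∷ A) B v w =
  trans (cong (_+_ (edgeFire v e w)) (fireChange-++ A B v w))
        (sym (+-assoc (edgeFire v e w) (fireChange A v w) (fireChange B v w)))

fireChange-tabulate : ∀ {N k} (f : Fin k → Fin N × Fin N) v →
                      fireChange (tabulate f) v ≗ ∑ᶜ (λ j → edgeFire v (f j))
fireChange-tabulate {k = zero} f v w = refl
fireChange-tabulate {k = suc k} f v w =
  cong (_+_ (edgeFire v (f zero) w)) (fireChange-tabulate (f ∘ suc) v w)

fireChange-nonincident : ∀ {N} (A : Graph N) v →
                         All (λ e → v ≢ proj₁ e × v ≢ proj₂ e) A → fireChange A v ≗ 𝟎
fireChange-nonincident [] v [] w = refl
fireChange-nonincident ((a , b) ∷ A) v ((v≢a , v≢b) ∷ rest) w rewrite 𝟙-≢ v≢a | 𝟙-≢ v≢b =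
  trans (vanish (δ b a w) (δ a b w) _) (fireChange-nonincident A v rest w)
  where
  vanish : ∀ p q r → + 0 * p + + 0 * q + r ≡ r
  vanish = solve-∀

module ChipFiring {N : ℕ} (G : Graph N) where
  private
    variable
      σ σ′ τ τ′ ρ D : Config N

  infix 4 _∼_ _∈⟨_⟩

  _∼_ : Config N → Config N → Set
  σ ∼ τ = σ ∼⟨ G ⟩ τ

  Move-respˡ : σ ≗ σ′ → Move G σ′ ρ → Move G σ ρ
  Move-respˡ σ≗σ′ (v , inj₁ fire) =
    v , inj₁ (λ w → trans (fire w) (cong (_+ fireChange G v w) (sym (σ≗σ′ w))))
  Move-respˡ σ≗σ′ (v , inj₂ borrow) =
    v , inj₂ (λ w → trans (borrow w) (cong (_- fireChange G v w) (sym (σ≗σ′ w))))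

  ∼-respˡ : σ ≗ σ′ → σ′ ∼ τ → σ ∼ τ
  ∼-respˡ σ≗σ′ (done σ′≗τ) = done (λ w → trans (σ≗σ′ w) (σ′≗τ w))
  ∼-respˡ σ≗σ′ (step move p) = step (Move-respˡ σ≗σ′ move) p

  ∼-trans : σ ∼ ρ → ρ ∼ τ → σ ∼ τ
  ∼-trans (done σ≗ρ) q = ∼-respˡ σ≗ρ q
  ∼-trans (step move p) q = step move (∼-trans p q)

  ∼-respʳ : σ ∼ τ′ → τ′ ≗ τ → σ ∼ τ
  ∼-respʳ p τ′≗τ = ∼-trans p (done τ′≗τ)

  Move-sym : Move G σ ρ → Move G ρ σ
  Move-sym {σ} (v , inj₁ fire) =
    v , inj₂ (λ w → trans (sym (i+j-j≡i (σ w) (fireChange G v w)))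
                          (cong (_- fireChange G v w) (sym (fire w))))
  Move-sym {σ} (v , inj₂ borrow) =
    v , inj₁ (λ w → trans (sym (i-j+j≡i (σ w) (fireChange G v w)))
                          (cong (_+ fireChange G v w) (sym (borrow w))))

  ∼-sym : σ ∼ τ → τ ∼ σ
  ∼-sym (done σ≗τ) = done (sym ∘ σ≗τ)
  ∼-sym (step move p) = ∼-trans (∼-sym p) (step (Move-sym move) (done (λ _ → refl)))

  Move-⊕ʳ : ∀ ρ → Move G σ τ → Move G (σ ⊕ ρ) (τ ⊕ ρ)
  Move-⊕ʳ {σ} ρ (v , inj₁ fire) =
    v , inj₁ (λ w → trans (cong (_+ ρ w) (fire w)) (swap (σ w) (fireChange G v w) (ρ w)))
    where
    swap : ∀ a c r → a + c + r ≡ a + r + c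
    swap = solve-∀
  Move-⊕ʳ {σ} ρ (v , inj₂ borrow) =
    v , inj₂ (λ w → trans (cong (_+ ρ w) (borrow w)) (swap (σ w) (fireChange G v w) (ρ w)))
    where
    swap : ∀ a c r → a - c + r ≡ a + r - c
    swap = solve-∀

  ∼-⊕ʳ : ∀ ρ → σ ∼ τ → σ ⊕ ρ ∼ τ ⊕ ρ
  ∼-⊕ʳ ρ (done σ≗τ) = done (λ w → cong (_+ ρ w) (σ≗τ w))
  ∼-⊕ʳ {σ} ρ (step {ρ′} move p) = step (Move-⊕ʳ {σ} {ρ′} ρ move) (∼-⊕ʳ ρ p)

  ∼-⊕ : σ ∼ τ → σ′ ∼ τ′ → σ ⊕ σ′ ∼ τ ⊕ τ′
  ∼-⊕ {σ} {τ} {σ′} {τ′} p q =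
    ∼-trans (∼-⊕ʳ σ′ p)
            (∼-respˡ (λ w → +-comm (τ w) (σ′ w)) (∼-respʳ (∼-⊕ʳ τ q) (λ w → +-comm (τ′ w) (τ w))))

  Move-⊝ : Move G σ τ → Move G (⊝ σ) (⊝ τ)
  Move-⊝ {σ} (v , inj₁ fire) =
    v , inj₂ (λ w → trans (cong -_ (fire w)) (neg-distrib-+ (σ w) (fireChange G v w)))
  Move-⊝ {σ} (v , inj₂ borrow) =
    v , inj₁ (λ w → trans (cong -_ (borrow w)) (neg-distrib-- (σ w) (fireChange G v w)))
    where
    neg-distrib-- : ∀ a c → - (a - c) ≡ - a + c
    neg-distrib-- = solve-∀

  ∼-⊝ : σ ∼ τ → ⊝ σ ∼ ⊝ τ
  ∼-⊝ (done σ≗τ) = done (λ w → cong -_ (σ≗τ w))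
  ∼-⊝ {σ} (step {ρ} move p) = step (Move-⊝ {σ} {ρ} move) (∼-⊝ p)

  ∼-·ℕ : ∀ k → σ ∼ τ → + k · σ ∼ + k · τ
  ∼-·ℕ zero p = done (λ _ → refl)
  ∼-·ℕ {σ} {τ} (suc k) p =
    ∼-respˡ (λ w → suc-* (+ k) (σ w)) (∼-respʳ (∼-⊕ p (∼-·ℕ k p)) (λ w → sym (suc-* (+ k) (τ w))))

  ∼-· : ∀ k → σ ∼ τ → k · σ ∼ k · τ
  ∼-· (+ k) p = ∼-·ℕ k p
  ∼-· {σ} {τ} -[1+ k ] p =
    ∼-respˡ (λ w → sym (neg-distribˡ-* (+ suc k) (σ w)))
            (∼-respʳ (∼-⊝ (∼-·ℕ (suc k) p)) (λ w → neg-distribˡ-* (+ suc k) (τ w)))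

  fireChange∼𝟎 : ∀ v → fireChange G v ∼ 𝟎
  fireChange∼𝟎 v = step (v , inj₂ (λ w → sym (+-inverseʳ (fireChange G v w)))) (done (λ _ → refl))

  _∈⟨_⟩ : Config N → Config N → Set
  σ ∈⟨ D ⟩ = ∃[ k ] σ ∼ k · D

  ∈⟨⟩-resp-∼ : σ ∼ τ → τ ∈⟨ D ⟩ → σ ∈⟨ D ⟩
  ∈⟨⟩-resp-∼ σ∼τ (k , τ∼kD) = k , ∼-trans σ∼τ τ∼kD

  ∈⟨⟩-resp-≗ : σ ≗ τ → τ ∈⟨ D ⟩ → σ ∈⟨ D ⟩
  ∈⟨⟩-resp-≗ σ≗τ = ∈⟨⟩-resp-∼ (done σ≗τ)

  ∼⇒∈⟨⟩ : σ ∼ D → σ ∈⟨ D ⟩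
  ∼⇒∈⟨⟩ {D = D} σ∼D = + 1 , ∼-respʳ σ∼D (λ w → sym (*-identityˡ (D w)))

  𝟎-∈⟨⟩ : 𝟎 ∈⟨ D ⟩
  𝟎-∈⟨⟩ = + 0 , done (λ _ → refl)

  ⊕-∈⟨⟩ : σ ∈⟨ D ⟩ → τ ∈⟨ D ⟩ → σ ⊕ τ ∈⟨ D ⟩
  ⊕-∈⟨⟩ {D = D} (k , σ∼kD) (l , τ∼lD) =
    k + l , ∼-respʳ (∼-⊕ σ∼kD τ∼lD) (λ w → sym (*-distribʳ-+ (D w) k l))

  ·-∈⟨⟩ : ∀ c → σ ∈⟨ D ⟩ → c · σ ∈⟨ D ⟩
  ·-∈⟨⟩ {D = D} c (k , σ∼kD) = c * k , ∼-respʳ (∼-· c σ∼kD) (λ w → sym (*-assoc c k (D w)))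

  ⊖-∈⟨⟩ : σ ∈⟨ D ⟩ → τ ∈⟨ D ⟩ → σ ⊖ τ ∈⟨ D ⟩
  ⊖-∈⟨⟩ {σ} {τ = τ} σ∈ τ∈ =
    ∈⟨⟩-resp-≗ (λ w → cong (_+_ (σ w)) (sym (-1*i≡-i (τ w))))
               (⊕-∈⟨⟩ σ∈ (·-∈⟨⟩ -[1+ 0 ] τ∈))

  ∑-∈⟨⟩ : ∀ {k} {f : Fin k → Config N} → (∀ j → f j ∈⟨ D ⟩) → ∑ᶜ f ∈⟨ D ⟩
  ∑-∈⟨⟩ {k = zero} _ = 𝟎-∈⟨⟩
  ∑-∈⟨⟩ {k = suc k} f∈ = ⊕-∈⟨⟩ (f∈ zero) (∑-∈⟨⟩ (f∈ ∘ suc))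

  fireChange-∈⟨⟩ : ∀ v → fireChange G v ∈⟨ D ⟩
  fireChange-∈⟨⟩ v = ∈⟨⟩-resp-∼ (fireChange∼𝟎 v) 𝟎-∈⟨⟩

  fireChange-∈⟨⟩-edges : ∀ (A : Graph N) v →
                         All (λ e → δ (proj₁ e) (proj₂ e) ∈⟨ D ⟩) A → fireChange A v ∈⟨ D ⟩
  fireChange-∈⟨⟩-edges [] v [] = 𝟎-∈⟨⟩
  fireChange-∈⟨⟩-edges ((a , b) ∷ A) v (δab∈ ∷ rest) =
    ⊕-∈⟨⟩ (∈⟨⟩-resp-≗ (edgeFire-δ v a b) (·-∈⟨⟩ (𝟙 v b - 𝟙 v a) δab∈))
          (fireChange-∈⟨⟩-edges A v rest)

  generatingPair-from-δ : ∀ a b (o : Fin N) → (∀ w → δ w o ∈⟨ δ a b ⟩) → GeneratingPair G a b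
  generatingPair-from-δ a b o δ∈ σ deg≡0 =
    ∈⟨⟩-resp-≗ (δ-expansion o σ deg≡0) (∑-∈⟨⟩ (λ w → ·-∈⟨⟩ (σ w) (δ∈ w)))

module Embedding {n : ℕ} (m : ℕ) where
  embed : Graph n → Graph (n ℕ.+ m)
  embed = map (λ { (a , b) → a ↑ˡ m , b ↑ˡ m })

  lift : Config n → Config (n ℕ.+ m)
  lift τ = τ Vector.++ 𝟎

  ↑ˡ≢↑ʳ : (u : Fin n) (j : Fin m) → u ↑ˡ m ≢ n ↑ʳ j
  ↑ˡ≢↑ʳ u j eq with trans (sym (splitAt-↑ˡ n u m)) (trans (cong (splitAt n) eq) (splitAt-↑ʳ n m j))
  ... | ()

  𝟙-↑ˡ : ∀ (a b : Fin n) → 𝟙 (a ↑ˡ m) (b ↑ˡ m) ≡ 𝟙 a b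
  𝟙-↑ˡ = 𝟙-injective (λ {a} {b} → ↑ˡ-injective m a b)

  data ↑-View : Fin (n ℕ.+ m) → Set where
    old : (u : Fin n) → ↑-View (u ↑ˡ m)
    new : (j : Fin m) → ↑-View (n ↑ʳ j)

  ↑-view : ∀ w → ↑-View w
  ↑-view w with splitAt n w in eq
  ... | inj₁ u = subst ↑-View (splitAt⁻¹-↑ˡ eq) (old u)
  ... | inj₂ j = subst ↑-View (splitAt⁻¹-↑ʳ eq) (new j)

  lift-cong : ∀ {σ τ} → σ ≗ τ → lift σ ≗ lift τ
  lift-cong σ≗τ w with splitAt n w
  ... | inj₁ u = σ≗τ u
  ... | inj₂ j = refl

  lift-𝟎 : lift 𝟎 ≗ 𝟎
  lift-𝟎 w with splitAt n w
  ... | inj₁ u = refl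
  ... | inj₂ j = refl

  lift-⊕ : ∀ σ τ → lift (σ ⊕ τ) ≗ lift σ ⊕ lift τ
  lift-⊕ σ τ w with splitAt n w
  ... | inj₁ u = refl
  ... | inj₂ j = refl

  lift-⊖ : ∀ σ τ → lift (σ ⊖ τ) ≗ lift σ ⊖ lift τ
  lift-⊖ σ τ w with splitAt n w
  ... | inj₁ u = refl
  ... | inj₂ j = refl

  lift-· : ∀ k σ → lift (k · σ) ≗ k · lift σ
  lift-· k σ w with splitAt n w
  ... | inj₁ u = refl
  ... | inj₂ j = sym (*-zeroʳ k)

  lift-δ : ∀ (a b : Fin n) → lift (δ a b) ≗ δ (a ↑ˡ m) (b ↑ˡ m)
  lift-δ a b w with ↑-view w
  ... | old u = trans (lookup-++ˡ (δ a b) 𝟎 u) (sym (cong₂ _-_ (𝟙-↑ˡ a u) (𝟙-↑ˡ b u)))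
  ... | new j =
    trans (lookup-++ʳ (δ a b) 𝟎 j) (sym (cong₂ _-_ (𝟙-≢ (↑ˡ≢↑ʳ a j)) (𝟙-≢ (↑ˡ≢↑ʳ b j))))

  fireChange-embed-↑ˡ : ∀ G u → fireChange (embed G) (u ↑ˡ m) ≗ lift (fireChange G u)
  fireChange-embed-↑ˡ [] u w = sym (lift-𝟎 w)
  fireChange-embed-↑ˡ ((a , b) ∷ G) u w = begin
    edgeFire (u ↑ˡ m) (a ↑ˡ m , b ↑ˡ m) w + rest
      ≡⟨ cong₂ _+_ (edgeFire-δ (u ↑ˡ m) (a ↑ˡ m) (b ↑ˡ m) w) (fireChange-embed-↑ˡ G u w) ⟩
    (𝟙 (u ↑ˡ m) (b ↑ˡ m) - 𝟙 (u ↑ˡ m) (a ↑ˡ m)) * δ (a ↑ˡ m) (b ↑ˡ m) w + lift (fireChange G u) w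
      ≡⟨ cong (_+ lift (fireChange G u) w)
              (cong₂ _*_ (cong₂ _-_ (𝟙-↑ˡ u b) (𝟙-↑ˡ u a)) (sym (lift-δ a b w))) ⟩
    (𝟙 u b - 𝟙 u a) * lift (δ a b) w + lift (fireChange G u) w
      ≡⟨ cong (_+ lift (fireChange G u) w) (sym (lift-· (𝟙 u b - 𝟙 u a) (δ a b) w)) ⟩
    lift ((𝟙 u b - 𝟙 u a) · δ a b) w + lift (fireChange G u) w
      ≡⟨ cong (_+ lift (fireChange G u) w) (sym (lift-cong (edgeFire-δ u a b) w)) ⟩
    lift (edgeFire u (a , b)) w + lift (fireChange G u) w
      ≡⟨ sym (lift-⊕ (edgeFire u (a , b)) (fireChange G u) w) ⟩
    lift (fireChange ((a , b) ∷ G) u) w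
      ∎
    where
    open ≡-Reasoning
    rest = fireChange (embed G) (u ↑ˡ m) w

  fireChange-embed-↑ʳ : ∀ G j → fireChange (embed G) (n ↑ʳ j) ≗ 𝟎
  fireChange-embed-↑ʳ G j = fireChange-nonincident (embed G) (n ↑ʳ j) (map⁺ (universal new∉ G))
    where
    new∉ : ∀ e → n ↑ʳ j ≢ proj₁ e ↑ˡ m × n ↑ʳ j ≢ proj₂ e ↑ˡ m
    new∉ (a , b) = (λ eq → ↑ˡ≢↑ʳ a j (sym eq)) , (λ eq → ↑ˡ≢↑ʳ b j (sym eq))

  module _ (G : Graph n) (P : Graph (n ℕ.+ m)) where
    open ChipFiring (embed G ++ P)

    lift-fireChange-∈⟨⟩ : ∀ {D} → (∀ u → fireChange P (u ↑ˡ m) ∈⟨ D ⟩) →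
                          ∀ u → lift (fireChange G u) ∈⟨ D ⟩
    lift-fireChange-∈⟨⟩ P∈ u = ∈⟨⟩-resp-≗ split (⊖-∈⟨⟩ (fireChange-∈⟨⟩ (u ↑ˡ m)) (P∈ u))
      where
      split : lift (fireChange G u) ≗ fireChange (embed G ++ P) (u ↑ˡ m) ⊖ fireChange P (u ↑ˡ m)
      split w = begin
        lift (fireChange G u) w
          ≡⟨ i+j-j≡i _ firedᴾ ⟨
        lift (fireChange G u) w + firedᴾ - firedᴾ
          ≡⟨ cong (λ e → e + firedᴾ - firedᴾ) (fireChange-embed-↑ˡ G u w) ⟨
        fireChange (embed G) (u ↑ˡ m) w + firedᴾ - firedᴾ
          ≡⟨ cong (_- firedᴾ) (fireChange-++ (embed G) P (u ↑ˡ m) w) ⟨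
        fireChange (embed G ++ P) (u ↑ˡ m) w - firedᴾ
          ∎
        where
        open ≡-Reasoning
        firedᴾ = fireChange P (u ↑ˡ m) w

    lift-∼ : ∀ {D τ τ′} → (∀ u → fireChange P (u ↑ˡ m) ∈⟨ D ⟩) →
             τ ∼⟨ G ⟩ τ′ → lift τ ⊖ lift τ′ ∈⟨ D ⟩
    lift-∼ {τ′ = τ′} P∈ (done τ≗τ′) =
      ∈⟨⟩-resp-≗ (λ w → trans (cong (_- lift τ′ w) (lift-cong τ≗τ′ w)) (+-inverseʳ (lift τ′ w)))
                 𝟎-∈⟨⟩
    lift-∼ {τ = τ} {τ′} P∈ (step {ρ} (v , inj₁ fire) ρ∼τ′) =
      ∈⟨⟩-resp-≗ fired (⊖-∈⟨⟩ (lift-∼ P∈ ρ∼τ′) (lift-fireChange-∈⟨⟩ P∈ v))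
      where
      fired : lift τ ⊖ lift τ′ ≗ lift ρ ⊖ lift τ′ ⊖ lift (fireChange G v)
      fired w = trans (regroup (lift τ w) (lift τ′ w) (lift (fireChange G v) w))
                      (cong (λ a → a - lift τ′ w - lift (fireChange G v) w)
                            (sym (trans (lift-cong fire w) (lift-⊕ τ (fireChange G v) w))))
        where
        regroup : ∀ t t′ l → t - t′ ≡ t + l - t′ - l
        regroup = solve-∀
    lift-∼ {τ = τ} {τ′} P∈ (step {ρ} (v , inj₂ borrow) ρ∼τ′) =
      ∈⟨⟩-resp-≗ borrowed (⊕-∈⟨⟩ (lift-∼ P∈ ρ∼τ′) (lift-fireChange-∈⟨⟩ P∈ v))
      where
      borrowed : lift τ ⊖ lift τ′ ≗ lift ρ ⊖ lift τ′ ⊕ lift (fireChange G v)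
      borrowed w = trans (regroup (lift τ w) (lift τ′ w) (lift (fireChange G v) w))
                         (cong (λ a → a - lift τ′ w + lift (fireChange G v) w)
                               (sym (trans (lift-cong borrow w) (lift-⊖ τ (fireChange G v) w))))
        where
        regroup : ∀ t t′ l → t - t′ ≡ t - l - t′ + l
        regroup = solve-∀

splitLast-inject₁ : ∀ m (a : Fin m) → splitLast m (inject₁ a) ≡ just a
splitLast-inject₁ (suc m) zero = refl
splitLast-inject₁ (suc m) (suc a) rewrite splitLast-inject₁ m a = refl

splitLast≡just⇒inject₁ : ∀ m (j : Fin (suc m)) {a} → splitLast m j ≡ just a → j ≡ inject₁ a
splitLast≡just⇒inject₁ (suc m) zero refl = refl
splitLast≡just⇒inject₁ (suc m) (suc j) eq with splitLast m j in eq′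
splitLast≡just⇒inject₁ (suc m) (suc j) refl | just b = cong suc (splitLast≡just⇒inject₁ m j eq′)

splitLast-fromℕ : ∀ m → splitLast m (fromℕ m) ≡ nothing
splitLast-fromℕ zero = refl
splitLast-fromℕ (suc m) rewrite splitLast-fromℕ m = refl

module AddPath {n : ℕ} (G : Graph n) (x y : Fin n) (m : ℕ) where
  open Embedding {n} m public

  x⟨_⟩ : Fin (suc (suc m)) → Fin (n ℕ.+ m)
  x⟨_⟩ = pathVertex x y m

  d : Fin (suc m) → Config (n ℕ.+ m)
  d j = δ x⟨ inject₁ j ⟩ x⟨ suc j ⟩

  path : Graph (n ℕ.+ m)
  path = map (λ j → x⟨ inject₁ j ⟩ , x⟨ suc j ⟩) (allFin (suc m))

  -- embed G ++ path unfolds to addPath G x y m.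
  open ChipFiring (embed G ++ path) public

  pathVertex-inner : ∀ a → x⟨ suc (inject₁ a) ⟩ ≡ n ↑ʳ a
  pathVertex-inner a rewrite splitLast-inject₁ m a = refl

  pathVertex-last : x⟨ suc (fromℕ m) ⟩ ≡ y ↑ˡ m
  pathVertex-last rewrite splitLast-fromℕ m = refl

  inner≡pathVertex⇒ : ∀ a t → n ↑ʳ a ≡ x⟨ t ⟩ → suc (inject₁ a) ≡ t
  inner≡pathVertex⇒ a zero eq = ⊥-elim (↑ˡ≢↑ʳ x a (sym eq))
  inner≡pathVertex⇒ a (suc j) eq with splitLast m j in eq′
  ... | just b  =
    cong suc (trans (cong inject₁ (↑ʳ-injective n a b eq)) (sym (splitLast≡just⇒inject₁ m j eq′)))
  ... | nothing = ⊥-elim (↑ˡ≢↑ʳ y a (sym eq))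

  𝟙-inner : ∀ a t → 𝟙 (n ↑ʳ a) x⟨ t ⟩ ≡ 𝟙 (suc (inject₁ a)) t
  𝟙-inner a t = 𝟙-cong-⇔ (mk⇔ (inner≡pathVertex⇒ a t) (λ { refl → sym (pathVertex-inner a) }))

  fireChange-inner : ∀ a → fireChange (embed G ++ path) (n ↑ʳ a) ≗ d (inject₁ a) ⊖ d (suc a)
  fireChange-inner a w = begin
    fireChange (embed G ++ path) v w
      ≡⟨ fireChange-++ (embed G) path v w ⟩
    fireChange (embed G) v w + fireChange path v w
      ≡⟨ cong (_+ fireChange path v w) (fireChange-embed-↑ʳ G a w) ⟩
    + 0 + fireChange path v w
      ≡⟨ +-identityˡ _ ⟩
    fireChange path v w
      ≡⟨ cong (λ A → fireChange A v w) (map-tabulate id edge) ⟩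
    fireChange (tabulate edge) v w
      ≡⟨ fireChange-tabulate edge v w ⟩
    ∑[ j < suc m ] edgeFire v (edge j) w
      ≡⟨ sum-cong-≗ (λ j → edgeFire-δ v x⟨ inject₁ j ⟩ x⟨ suc j ⟩ w) ⟩
    ∑[ j < suc m ] ((𝟙 v x⟨ suc j ⟩ - 𝟙 v x⟨ inject₁ j ⟩) * d j w)
      ≡⟨ sum-cong-≗ (λ j → cong (_* d j w) (cong₂ _-_ (𝟙-next j) (𝟙-previous j))) ⟩
    ∑[ j < suc m ] (δ (inject₁ a) (suc a) j * d j w)
      ≡⟨ ∑-δ-* (inject₁ a) (suc a) (λ j → d j w) ⟩
    d (inject₁ a) w - d (suc a) w
      ∎
    where
    open ≡-Reasoning
    v = n ↑ʳ a
    edge : Fin (suc m) → Fin (n ℕ.+ m) × Fin (n ℕ.+ m)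
    edge j = x⟨ inject₁ j ⟩ , x⟨ suc j ⟩
    𝟙-next : ∀ j → 𝟙 v x⟨ suc j ⟩ ≡ 𝟙 (inject₁ a) j
    𝟙-next j = trans (𝟙-inner a (suc j)) (𝟙-injective suc-injective (inject₁ a) j)
    𝟙-previous : ∀ j → 𝟙 v x⟨ inject₁ j ⟩ ≡ 𝟙 (suc a) j
    𝟙-previous j = trans (𝟙-inner a (inject₁ j)) (𝟙-injective inject₁-injective (suc a) j)

  d∼d₀ : ∀ j → d j ∼ d zero
  d∼d₀ = <-weakInduction (λ j → d j ∼ d zero) (done (λ _ → refl)) fire-inner
    where
    fire-inner : ∀ a → d (inject₁ a) ∼ d zero → d (suc a) ∼ d zero
    fire-inner a = ∼-trans (step (n ↑ʳ a , inj₁ (λ _ → refl)) (done fired))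
      where
      fired : d (suc a) ⊕ fireChange (embed G ++ path) (n ↑ʳ a) ≗ d (inject₁ a)
      fired w = trans (cong (_+_ (d (suc a) w)) (fireChange-inner a w))
                      (i+[j-i]≡j (d (suc a) w) (d (inject₁ a) w))

  d-∈⟨d⟩ : ∀ i j → d j ∈⟨ d i ⟩
  d-∈⟨d⟩ i j = ∼⇒∈⟨⟩ (∼-trans (d∼d₀ j) (∼-sym (d∼d₀ i)))

  fireChange-path-∈⟨d⟩ : ∀ i v → fireChange path v ∈⟨ d i ⟩
  fireChange-path-∈⟨d⟩ i v = fireChange-∈⟨⟩-edges path v (map⁺ (tabulate⁺ {f = id} (d-∈⟨d⟩ i)))

  δ-path-∈⟨d⟩ : ∀ i t → δ x⟨ t ⟩ x⟨ zero ⟩ ∈⟨ d i ⟩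
  δ-path-∈⟨d⟩ i = <-weakInduction (λ t → δ x⟨ t ⟩ x⟨ zero ⟩ ∈⟨ d i ⟩) δ-x₀-x₀-∈ extend
    where
    δ-x₀-x₀-∈ : δ x⟨ zero ⟩ x⟨ zero ⟩ ∈⟨ d i ⟩
    δ-x₀-x₀-∈ = ∈⟨⟩-resp-≗ (λ w → +-inverseʳ (𝟙 x⟨ zero ⟩ w)) 𝟎-∈⟨⟩
    extend : ∀ j → δ x⟨ inject₁ j ⟩ x⟨ zero ⟩ ∈⟨ d i ⟩ → δ x⟨ suc j ⟩ x⟨ zero ⟩ ∈⟨ d i ⟩
    extend j δ∈ =
      ∈⟨⟩-resp-≗ (λ w → regroup (𝟙 x⟨ inject₁ j ⟩ w) (𝟙 x⟨ suc j ⟩ w) (𝟙 x⟨ zero ⟩ w))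
                 (⊖-∈⟨⟩ δ∈ (d-∈⟨d⟩ i j))
      where
      regroup : ∀ p q o → q - o ≡ p - o - (p - q)
      regroup = solve-∀

  δ-old-∈⟨d⟩ : GeneratingPair G x y → ∀ i u → δ (u ↑ˡ m) x⟨ zero ⟩ ∈⟨ d i ⟩
  δ-old-∈⟨d⟩ gp i u with gp (δ u x) (degree-δ u x)
  ... | k , δux∼kδxy = ∈⟨⟩-resp-≗ reassemble (⊖-∈⟨⟩ lifted (·-∈⟨⟩ k δyx∈))
    where
    lifted : lift (δ u x) ⊖ lift (k · δ x y) ∈⟨ d i ⟩
    lifted = lift-∼ G path (λ u → fireChange-path-∈⟨d⟩ i (u ↑ˡ m)) δux∼kδxy
    δyx∈ : δ (y ↑ˡ m) (x ↑ˡ m) ∈⟨ d i ⟩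
    δyx∈ = subst (λ z → δ z (x ↑ˡ m) ∈⟨ d i ⟩) pathVertex-last (δ-path-∈⟨d⟩ i (suc (fromℕ m)))
    reassemble : δ (u ↑ˡ m) (x ↑ˡ m) ≗ lift (δ u x) ⊖ lift (k · δ x y) ⊖ k · δ (y ↑ˡ m) (x ↑ˡ m)
    reassemble w = begin
      U - X
        ≡⟨ regroup U X Y k ⟩
      U - X - k * (X - Y) - k * (Y - X)
        ≡⟨ cong₂ (λ a b → a - b - k * (Y - X)) (lift-δ u x w) lift-kδxy ⟨
      lift (δ u x) w - lift (k · δ x y) w - k * (Y - X)
        ∎
      where
      open ≡-Reasoning
      U = 𝟙 (u ↑ˡ m) w
      X = 𝟙 (x ↑ˡ m) w
      Y = 𝟙 (y ↑ˡ m) w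
      lift-kδxy : lift (k · δ x y) w ≡ k * (X - Y)
      lift-kδxy = trans (lift-· k (δ x y) w) (cong (_*_ k) (lift-δ x y w))
      regroup : ∀ a p q k → a - p ≡ a - p - k * (p - q) - k * (q - p)
      regroup = solve-∀

theorem2p4 : {n : ℕ} (G : Graph n) → Connected G → (x y : Fin n) → x ≢ y
    → GeneratingPair G x y → (m : ℕ) → (i : Fin (suc m))
    → GeneratingPair (addPath G x y m) (pathVertex x y m (inject₁ i)) (pathVertex x y m (suc i))
theorem2p4 G _ x y _ gp m i = generatingPair-from-δ x⟨ inject₁ i ⟩ x⟨ suc i ⟩ x⟨ zero ⟩ δ-∈⟨d⟩
  where
  open AddPath G x y m
  δ-∈⟨d⟩ : ∀ w → δ w x⟨ zero ⟩ ∈⟨ d i ⟩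
  δ-∈⟨d⟩ w with ↑-view w
  ... | old u = δ-old-∈⟨d⟩ gp i u
  ... | new j =
    subst (λ z → δ z x⟨ zero ⟩ ∈⟨ d i ⟩) (pathVertex-inner j) (δ-path-∈⟨d⟩ i (suc (inject₁ j)))
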